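{- Let $T$ be a tree-like tableau, $e$ a boundary edge of $T$, and $T'=\mathrm{Insertpoint}(T,e)$. Then the special point of $T'$ is the new point added during the insertion.
   Context: A Ferrers diagram is a finite set of unit cells of $\mathbb{Z}^2$ forming left-justified rows whose lengths weakly decrease from top to bottom, considered up to translation. Its boundary edges are the unit edges on its Southeast border path; a boundary cell is a cell with no other cell to its Southeast; these are ordered Southwest to Northeast along the border path. A tree-like tableau is a Ferrers diagram in which each cell is empty or pointed, such that: (1) the top-left cell is pointed (root point); (2) every non-root pointed cell has either a pointed cell above it in its column or a pointed cell to its left in its row, but not both; (3) every row and column contains a pointed cell. The special point of a tree-like tableau is the Northeast-most (rightmost) among the pointed cells which are the lowest cell of their column. Inserting a column at a boundary edge $e$ at the right end of a row $r$ means adding a cell at the right end of $r$ and of every row above $r$; inserting a row at a boundary edge $e$ at the bottom of a column $c$ means adding a cell at the bottom of $c$ and of every column to its left. $\mathrm{Insertpoint}(T,e)$: let $T'$ be obtained by inserting a column (if $e$ vertical) or row (if $e$ horizontal) at $e$, with new cells empty except the lowest cell of the new column (resp. rightmost cell of the new row), which is pointed (the new point). If $e$ lies Northeast of the special point of $T$ along the border path (after the bottom edge of the special cell), the result is $T'$. Otherwise one adds to $T'$ the ribbon of empty cells (connected, no $2\times2$ square, union with $T'$ a Ferrers diagram) from the cell immediately right of the new point to the cell immediately below the special point of $T$ (nothing if $e$ is the bottom edge of the special cell). -}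

module Defs where

open import Data.Bool using (Bool; true; false; if_then_else_)
open import Data.Nat using (ℕ; zero; suc; _+_; _∸_; _≤_; _<_; _<ᵇ_; _≤ᵇ_; _≡ᵇ_)
open import Data.List using (List; []; _∷_; length; take; drop; replicate; _++_; [_])
open import Data.Maybe using (Maybe; just; nothing)
open import Data.Product using (Σ; ∃; ∃-syntax; _×_; _,_)
open import Data.Sum using (_⊎_)
open import Relation.Nullary using (¬_)
open import Relation.Binary.PropositionalEquality using (_≡_)

-- A filling of a diagram is a list of rows, listed from top to bottom;
-- each row is a list of cells listed from left to right; a cell is
-- `true` (pointed) or `false` (empty).  Cell (i , j) is in row i (0 = top)
-- and column j (0 = leftmost).  Diagrams are left-justified, so this
-- representation is canonical up to translation.

Filling : Set
Filling = List (List Bool)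

nth : {A : Set} → List A → ℕ → Maybe A
nth []       _       = nothing
nth (x ∷ xs) zero    = just x
nth (x ∷ xs) (suc n) = nth xs n

-- content of cell (i , j): nothing = not a cell of the diagram
at : Filling → ℕ → ℕ → Maybe Bool
at T i j with nth T i
... | nothing = nothing
... | just r  = nth r j

Pointed : Filling → ℕ → ℕ → Set
Pointed T i j = at T i j ≡ just true

IsCell : Filling → ℕ → ℕ → Set
IsCell T i j = ∃[ b ] (at T i j ≡ just b)

nrows : Filling → ℕ
nrows = length

rowLen : Filling → ℕ → ℕ
rowLen T i with nth T i
... | nothing = 0
... | just r  = length r

ncols : Filling → ℕ
ncols T = rowLen T 0

-- height of column c (number of rows having a cell in column c;
-- these form a prefix of the rows in a Ferrers diagram)
colHeight : Filling → ℕ → ℕ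
colHeight []       c = 0
colHeight (r ∷ rs) c = if c <ᵇ length r then suc (colHeight rs c) else 0

record IsFerrers (T : Filling) : Set where
  field
    rows-nonempty : ∀ i r → nth T i ≡ just r → 1 ≤ length r
    rows-decrease : ∀ i r r' → nth T i ≡ just r → nth T (suc i) ≡ just r' →
                    length r' ≤ length r

PointAbove : Filling → ℕ → ℕ → Set
PointAbove T i j = ∃[ i' ] (i' < i × Pointed T i' j)

PointLeft : Filling → ℕ → ℕ → Set
PointLeft T i j = ∃[ j' ] (j' < j × Pointed T i j')

record IsTreeLike (T : Filling) : Set where
  field
    ferrers : IsFerrers T
    root    : Pointed T 0 0
    tree    : ∀ i j → Pointed T i j → ¬ (i ≡ 0 × j ≡ 0) →
              (PointAbove T i j × ¬ PointLeft T i j) ⊎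
              (¬ PointAbove T i j × PointLeft T i j)
    rowPt   : ∀ i j → IsCell T i j → ∃[ j' ] Pointed T i j'
    colPt   : ∀ i j → IsCell T i j → ∃[ i' ] Pointed T i' j

LowestInColumn : Filling → ℕ → ℕ → Set
LowestInColumn T i j = ∀ k → i < k → at T k j ≡ nothing

IsSpecialPoint : Filling → ℕ × ℕ → Set
IsSpecialPoint T (i , j) =
  Pointed T i j × LowestInColumn T i j ×
  (∀ i' j' → Pointed T i' j' → LowestInColumn T i' j' → j' ≤ j)

-- vert r  : the vertical boundary edge at the right end of row r
-- horiz c : the horizontal boundary edge at the bottom of column c
data Edge : Set where
  vert  : ℕ → Edge
  horiz : ℕ → Edge

IsBoundaryEdge : Filling → Edge → Set
IsBoundaryEdge T (vert r)  = r < nrows T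
IsBoundaryEdge T (horiz c) = c < ncols T

-- position of a boundary edge along the border path, counted from the
-- Southwest end (0) to the Northeast end (nrows + ncols - 1)
edgePos : Filling → Edge → ℕ
edgePos T (vert r)  = rowLen T r + (nrows T ∸ suc r)
edgePos T (horiz c) = c + (nrows T ∸ colHeight T c)

insertAt : {A : Set} → ℕ → A → List A → List A
insertAt n x xs = take n xs ++ x ∷ drop n xs

insCol : ℕ → ℕ → Filling → Filling
insCol L r []       = []
insCol L zero    (x ∷ xs) = insertAt L true x ∷ xs
insCol L (suc r) (x ∷ xs) = insertAt L false x ∷ insCol L r xs

insertLine : Filling → Edge → Filling
insertLine T (vert r)  = insCol (rowLen T r) r T
insertLine T (horiz c) =
  insertAt (colHeight T c) (replicate c false ++ [ true ]) T

-- the new point, in the coordinates of T' (and of the final tableau)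
newPoint : Filling → Edge → ℕ × ℕ
newPoint T (vert r)  = (r , rowLen T r)
newPoint T (horiz c) = (colHeight T c , c)

shiftCell : Filling → Edge → ℕ × ℕ → ℕ × ℕ
shiftCell T (vert r)  (i , j) = (i , (if rowLen T r ≤ᵇ j then suc j else j))
shiftCell T (horiz c) (i , j) = ((if colHeight T c ≤ᵇ i then suc i else i) , j)

pad : ℕ → List Bool → List Bool
pad n r = r ++ replicate (n ∸ length r) false

-- addRibbon bi bj ai T : add to T the ribbon of empty cells along the
-- Southeast border whose Northeast end is the cell (bi , bj) (lying in
-- row bi, immediately right of the existing cells of that row) and whose
-- Southwest end is in row ai (immediately right of the existing cells of
-- that row).  Row bi is extended to length bj + 1; every row i with
-- bi < i ≤ ai is extended to (length of row i-1 of T) + 1, which is the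
-- unique way to obtain a connected skew shape with no 2x2 square.
addRibbonGo : ℕ → ℕ → ℕ → ℕ → ℕ → Filling → Filling
addRibbonGo bi bj ai i prev []       = []
addRibbonGo bi bj ai i prev (x ∷ xs) =
  (if i ≡ᵇ bi then pad (suc bj) x
   else (if (bi <ᵇ i) Data.Bool.∧ (i ≤ᵇ ai) then pad (suc prev) x else x))
  ∷ addRibbonGo bi bj ai (suc i) (length x) xs

addRibbon : ℕ → ℕ → ℕ → Filling → Filling
addRibbon bi bj ai T = addRibbonGo bi bj ai 0 0 T

-- Insertpoint(T , e), given the special point s of T

insertPoint : (T : Filling) → Edge → (s : ℕ × ℕ) → Filling
insertPoint T e (si , sj) =
  if edgePos T (horiz sj) <ᵇ edgePos T e
  then T'
  else addRibbon (suc si') sj' (Data.Product.proj₁ (newPoint T e)) T'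
  where
  T' = insertLine T e
  s' = shiftCell T e (si , sj)
  si' = Data.Product.proj₁ s'
  sj' = Data.Product.proj₂ s'

module Submission where

open import Defs
open import Data.Bool using (Bool; true; false; if_then_else_; _∧_)
open import Data.Empty using (⊥-elim)
open import Data.Nat using (ℕ; zero; suc; _+_; _∸_; _≤_; _<_; _<ᵇ_; _≤ᵇ_; _≡ᵇ_; z≤n; s≤s; z<s)
open import Data.Nat.Properties
open import Data.List using (List; []; _∷_; length; replicate; _++_; [_])
open import Data.List.Properties using (length-++; length-replicate)
open import Data.Maybe using (Maybe; just; nothing)
open import Data.Product using (∃-syntax; _×_; _,_; proj₁; proj₂)
open import Data.Sum using (_⊎_; inj₁; inj₂)
open import Function.Bundles using (_⇔_; mk⇔; Equivalence)
open import Relation.Nullary using (¬_; yes; no; ofʸ; ofⁿ)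
open import Relation.Nullary.Decidable using (dec-true; dec-false)
open import Relation.Binary.Definitions using (tri<; tri≈; tri>)
open import Relation.Binary.PropositionalEquality hiding ([_])

-- The new point (a , b) is the lowest cell of its column, so it is the special point as soon
-- as every point strictly right of column b has a cell below it.  Such a point comes from a
-- point of T above row a.  Lying Northeast of the special point (si , sj) along the border
-- means sj < b; then that point of T lies right of column sj, so it is not lowest in its
-- column and keeps its cell below.  Otherwise b ≤ sj, and a point of T without a cell below
-- lies weakly left of column sj (as (si , sj) is special) and weakly below row si (rows
-- above si reach beyond column sj): exactly where the ribbon, running from below (si , sj)
-- down to row a, adds the missing cells.

≡ᵇ-refl : ∀ n → (n ≡ᵇ n) ≡ true
≡ᵇ-refl n = dec-true (n ≟ n) refl

≡ᵇ-false : ∀ {m n} → m ≢ n → (m ≡ᵇ n) ≡ false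
≡ᵇ-false {m} {n} = dec-false (m ≟ n)

<ᵇ-true : ∀ {m n} → m < n → (m <ᵇ n) ≡ true
<ᵇ-true {m} {n} = dec-true (m <? n)

≤ᵇ-true : ∀ {m n} → m ≤ n → (m ≤ᵇ n) ≡ true
≤ᵇ-true {m} {n} = dec-true (m ≤? n)

≤ᵇ-false : ∀ {m n} → ¬ m ≤ n → (m ≤ᵇ n) ≡ false
≤ᵇ-false {m} {n} = dec-false (m ≤? n)

module _ {A : Set} where

  nth-just⇒< : ∀ (xs : List A) i {x} → nth xs i ≡ just x → i < length xs
  nth-just⇒< (_ ∷ _)  zero    _  = z<s
  nth-just⇒< (_ ∷ xs) (suc i) eq = s≤s (nth-just⇒< xs i eq)

  nth-nothing⇒≥ : ∀ (xs : List A) i → nth xs i ≡ nothing → length xs ≤ i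
  nth-nothing⇒≥ []       _       _  = z≤n
  nth-nothing⇒≥ (_ ∷ xs) (suc i) eq = s≤s (nth-nothing⇒≥ xs i eq)

  ≥⇒nth-nothing : ∀ (xs : List A) i → length xs ≤ i → nth xs i ≡ nothing
  ≥⇒nth-nothing []       _       _         = refl
  ≥⇒nth-nothing (_ ∷ xs) (suc i) (s≤s le)  = ≥⇒nth-nothing xs i le

  <⇒nth-just : ∀ (xs : List A) i → i < length xs → ∃[ x ] nth xs i ≡ just x
  <⇒nth-just (x ∷ _)  zero    _         = x , refl
  <⇒nth-just (_ ∷ xs) (suc i) (s≤s lt)  = <⇒nth-just xs i lt

  nth-++ˡ : ∀ (xs ys : List A) i {x} → nth xs i ≡ just x → nth (xs ++ ys) i ≡ just x
  nth-++ˡ (_ ∷ _)  ys zero    eq = eq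
  nth-++ˡ (_ ∷ xs) ys (suc i) eq = nth-++ˡ xs ys i eq

  length-insertAt : ∀ n (y : A) xs → n ≤ length xs → length (insertAt n y xs) ≡ suc (length xs)
  length-insertAt zero    y xs       _         = refl
  length-insertAt (suc n) y (x ∷ xs) (s≤s le)  = cong suc (length-insertAt n y xs le)

  nth-insertAt-≡ : ∀ n (y : A) xs → n ≤ length xs → nth (insertAt n y xs) n ≡ just y
  nth-insertAt-≡ zero    y xs       _         = refl
  nth-insertAt-≡ (suc n) y (x ∷ xs) (s≤s le)  = nth-insertAt-≡ n y xs le

  nth-insertAt-< : ∀ n (y : A) xs i → n ≤ length xs → i < n → nth (insertAt n y xs) i ≡ nth xs i
  nth-insertAt-< (suc n) y (x ∷ xs) zero    _        _        = refl
  nth-insertAt-< (suc n) y (x ∷ xs) (suc i) (s≤s le) (s≤s lt) = nth-insertAt-< n y xs i le lt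

  nth-insertAt-> : ∀ n (y : A) xs i → n ≤ i → nth (insertAt n y xs) (suc i) ≡ nth xs i
  nth-insertAt-> zero    y xs       i       _        = refl
  nth-insertAt-> (suc n) y []       (suc i) _        = refl
  nth-insertAt-> (suc n) y (x ∷ xs) (suc i) (s≤s le) = nth-insertAt-> n y xs i le

nth-replicate-false : ∀ m j → nth (replicate m false) j ≢ just true
nth-replicate-false (suc m) zero    ()
nth-replicate-false (suc m) (suc j) eq = nth-replicate-false m j eq

nth-++-replicate-false : ∀ xs m j → nth (xs ++ replicate m false) j ≡ just true →
                         nth xs j ≡ just true
nth-++-replicate-false []       m j       eq = ⊥-elim (nth-replicate-false m j eq)
nth-++-replicate-false (x ∷ xs) m zero    eq = eq
nth-++-replicate-false (x ∷ xs) m (suc j) eq = nth-++-replicate-false xs m j eq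

length-pad : ∀ n xs → length (pad n xs) ≡ length xs + (n ∸ length xs)
length-pad n xs = trans (length-++ xs) (cong (length xs +_) (length-replicate (n ∸ length xs)))

≤-length-pad : ∀ n xs → n ≤ length (pad n xs)
≤-length-pad n xs = subst (n ≤_) (sym (length-pad n xs)) (m≤n+m∸n n (length xs))

length-≤-length-pad : ∀ n xs → length xs ≤ length (pad n xs)
length-≤-length-pad n xs = subst (length xs ≤_) (sym (length-pad n xs)) (m≤m+n (length xs) _)

record RowExtension (x y : List Bool) : Set where
  field
    keeps-cells   : ∀ j {c} → nth x j ≡ just c → nth y j ≡ just c
    no-new-points : ∀ j → nth y j ≡ just true → nth x j ≡ just true
    length-≤      : length x ≤ length y

RowExtension-refl : ∀ x → RowExtension x x
RowExtension-refl x = record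
  { keeps-cells   = λ _ eq → eq
  ; no-new-points = λ _ eq → eq
  ; length-≤      = ≤-refl
  }

RowExtension-pad : ∀ n x → RowExtension x (pad n x)
RowExtension-pad n x = record
  { keeps-cells   = λ j → nth-++ˡ x _ j
  ; no-new-points = λ j → nth-++-replicate-false x _ j
  ; length-≤      = length-≤-length-pad n x
  }

-- Variants of `at` and `rowLen` that are functions of the row `nth T i`, so that they can be
-- transported along equations between rows.
cellOf : Maybe (List Bool) → ℕ → Maybe Bool
cellOf nothing  _ = nothing
cellOf (just x) j = nth x j

widthOf : Maybe (List Bool) → ℕ
widthOf nothing  = 0
widthOf (just x) = length x

at′ : Filling → ℕ → ℕ → Maybe Bool
at′ T i = cellOf (nth T i)

rowLen′ : Filling → ℕ → ℕ
rowLen′ T i = widthOf (nth T i)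

at≡at′ : ∀ T i j → at T i j ≡ at′ T i j
at≡at′ T i j with nth T i
... | nothing = refl
... | just _  = refl

rowLen≡rowLen′ : ∀ T i → rowLen T i ≡ rowLen′ T i
rowLen≡rowLen′ T i with nth T i
... | nothing = refl
... | just _  = refl

at′-just⇒< : ∀ T i j {c} → at′ T i j ≡ just c → j < rowLen′ T i
at′-just⇒< T i j eq with nth T i
... | just x = nth-just⇒< x j eq

≥⇒at′-nothing : ∀ T i j → rowLen′ T i ≤ j → at′ T i j ≡ nothing
≥⇒at′-nothing T i j le with nth T i
... | nothing = refl
... | just x  = ≥⇒nth-nothing x j le

at′-nothing⇒≥ : ∀ T i j → at′ T i j ≡ nothing → rowLen′ T i ≤ j
at′-nothing⇒≥ T i j eq with nth T i
... | nothing = z≤n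
... | just x  = nth-nothing⇒≥ x j eq

isSpecialPoint-intro : ∀ T a b → at′ T a b ≡ just true →
  (∀ k → a < k → rowLen′ T k ≤ b) →
  (∀ i j → at′ T i j ≡ just true → b < j → j < rowLen′ T (suc i)) →
  IsSpecialPoint T (a , b)
isSpecialPoint-intro T a b pointed short covered = pointed′ , lowest , rightmost
  where
  pointed′ : Pointed T a b
  pointed′ = trans (at≡at′ T a b) pointed
  lowest : LowestInColumn T a b
  lowest k a<k = trans (at≡at′ T k b) (≥⇒at′-nothing T k b (short k a<k))
  rightmost : ∀ i j → Pointed T i j → LowestInColumn T i j → j ≤ b
  rightmost i j pt low with j ≤? b
  ... | yes j≤b = j≤b
  ... | no  j≰b = ⊥-elim (<⇒≱ cellBelow noCellBelow)
    where
    cellBelow : j < rowLen′ T (suc i)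
    cellBelow = covered i j (trans (sym (at≡at′ T i j)) pt) (≰⇒> j≰b)
    noCellBelow : rowLen′ T (suc i) ≤ j
    noCellBelow =
      at′-nothing⇒≥ T (suc i) j (trans (sym (at≡at′ T (suc i) j)) (low (suc i) (n<1+n i)))

special-pointed : ∀ T {si sj} → IsSpecialPoint T (si , sj) → at′ T si sj ≡ just true
special-pointed T {si} {sj} (pointed , _) = trans (sym (at≡at′ T si sj)) pointed

<colHeight⇒< : ∀ T j i → i < colHeight T j → j < rowLen′ T i
<colHeight⇒< (x ∷ xs) j i i<h with j <ᵇ length x | <ᵇ-reflects-< j (length x)
<colHeight⇒< (x ∷ xs) j zero    _         | true | ofʸ j<x = j<x
<colHeight⇒< (x ∷ xs) j (suc i) (s≤s i<h) | true | ofʸ _   = <colHeight⇒< xs j i i<h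

≤colHeight : ∀ T j m → (∀ i → i < m → j < rowLen′ T i) → m ≤ colHeight T j
≤colHeight T        j zero    _     = z≤n
≤colHeight []       j (suc m) cells = ⊥-elim (<⇒≱ (cells 0 z<s) z≤n)
≤colHeight (x ∷ xs) j (suc m) cells rewrite <ᵇ-true (cells 0 z<s) =
  s≤s (≤colHeight xs j m (λ i i<m → cells (suc i) (s≤s i<m)))

colHeight≤ : ∀ T j r → rowLen′ T r ≤ j → colHeight T j ≤ r
colHeight≤ []       j r       _  = z≤n
colHeight≤ (x ∷ xs) j r       le with j <ᵇ length x | <ᵇ-reflects-< j (length x)
colHeight≤ (x ∷ xs) j r       le | false | ofⁿ _   = z≤n
colHeight≤ (x ∷ xs) j zero    le | true  | ofʸ j<x = ⊥-elim (<⇒≱ j<x le)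
colHeight≤ (x ∷ xs) j (suc r) le | true  | ofʸ _   = s≤s (colHeight≤ xs j r le)

rowLen′-colHeight : ∀ T j → rowLen′ T (colHeight T j) ≤ j
rowLen′-colHeight []       j = z≤n
rowLen′-colHeight (x ∷ xs) j with j <ᵇ length x | <ᵇ-reflects-< j (length x)
... | true  | ofʸ _   = rowLen′-colHeight xs j
... | false | ofⁿ j≮x = ≮⇒≥ j≮x

colHeight≤length : ∀ T j → colHeight T j ≤ length T
colHeight≤length []       j = z≤n
colHeight≤length (x ∷ xs) j with j <ᵇ length x
... | true  = s≤s (colHeight≤length xs j)
... | false = z≤n

-- Ferrers shapes

module FerrersShape {T : Filling} (F : IsFerrers T) where
  open IsFerrers F

  rowLen′-suc-≤ : ∀ i → rowLen′ T (suc i) ≤ rowLen′ T i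
  rowLen′-suc-≤ i with nth T (suc i) in eq
  ... | nothing = z≤n
  ... | just x′ with <⇒nth-just T i (<-trans (n<1+n i) (nth-just⇒< T (suc i) eq))
  ...   | x , eq′ rewrite eq′ = rows-decrease i x x′ eq′ eq

  rowLen′-antitone : ∀ {i k} → i ≤ k → rowLen′ T k ≤ rowLen′ T i
  rowLen′-antitone {k = zero} z≤n = ≤-refl
  rowLen′-antitone {k = suc k} i≤k with m≤n⇒m<n∨m≡n i≤k
  ... | inj₁ i<k  = ≤-trans (rowLen′-suc-≤ k) (rowLen′-antitone (≤-pred i<k))
  ... | inj₂ refl = ≤-refl

  shorter-next-row⇒LowestInColumn : ∀ i j → rowLen′ T (suc i) ≤ j → LowestInColumn T i j
  shorter-next-row⇒LowestInColumn i j le k i<k =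
    trans (at≡at′ T k j) (≥⇒at′-nothing T k j (≤-trans (rowLen′-antitone i<k) le))

  right-of-special⇒cellBelow : ∀ {si sj} → IsSpecialPoint T (si , sj) →
    ∀ i j → at′ T i j ≡ just true → sj < j → j < rowLen′ T (suc i)
  right-of-special⇒cellBelow (_ , _ , rightmost) i j pt sj<j with j <? rowLen′ T (suc i)
  ... | yes below = below
  ... | no  ¬below = ⊥-elim (<⇒≱ sj<j (rightmost i j (trans (at≡at′ T i j) pt)
                                        (shorter-next-row⇒LowestInColumn i j (≮⇒≥ ¬below))))

  cellBelow⊎southwest-of-special : ∀ {si sj} → IsSpecialPoint T (si , sj) →
    ∀ i j → at′ T i j ≡ just true → j < rowLen′ T (suc i) ⊎ (si ≤ i × j ≤ sj)
  cellBelow⊎southwest-of-special {si} {sj} special i j pt with sj <? j | i <? si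
  ... | yes sj<j | _        = inj₁ (right-of-special⇒cellBelow special i j pt sj<j)
  ... | no  sj≮j | yes i<si =
    inj₁ (≤-<-trans (≮⇒≥ sj≮j) (<-≤-trans sj<rowLen (rowLen′-antitone i<si)))
    where
    sj<rowLen = at′-just⇒< T si sj (special-pointed T special)
  ... | no  sj≮j | no  i≮si = inj₂ (≮⇒≥ i≮si , ≮⇒≥ sj≮j)

  at′-just⇒<colHeight : ∀ i j {c} → at′ T i j ≡ just c → i < colHeight T j
  at′-just⇒<colHeight i j eq =
    ≤colHeight T j (suc i) λ i′ i′≤i →
      <-≤-trans (at′-just⇒< T i j eq) (rowLen′-antitone (≤-pred i′≤i))

  colHeight-antitone : ∀ {j j′} → j ≤ j′ → colHeight T j′ ≤ colHeight T j
  colHeight-antitone {j} {j′} j≤j′ =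
    ≤colHeight T j (colHeight T j′) (λ i i<h → ≤-<-trans j≤j′ (<colHeight⇒< T j′ i i<h))

newRow : Filling → Edge → ℕ
newRow T e = proj₁ (newPoint T e)

newColumn : Filling → Edge → ℕ
newColumn T e = proj₂ (newPoint T e)

module _ {T : Filling} (F : IsFerrers T) where
  open FerrersShape F

  private
    n : ℕ
    n = length T

  edgePos-vert≤horiz⇔ : ∀ {r} → r < length T → ∀ s →
    edgePos T (vert r) ≤ edgePos T (horiz s) ⇔ rowLen T r ≤ s
  edgePos-vert≤horiz⇔ {r} r<n s rewrite rowLen≡rowLen′ T r = mk⇔ to from
    where
    to : rowLen′ T r + (n ∸ suc r) ≤ s + (n ∸ colHeight T s) → rowLen′ T r ≤ s
    to le with rowLen′ T r ≤? s
    ... | yes L≤s = L≤s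
    ... | no  L≰s = ⊥-elim (<⇒≱ (+-mono-<-≤ (≰⇒> L≰s) (∸-monoʳ-≤ n r<h)) le)
      where
      r<h : suc r ≤ colHeight T s
      r<h = ≤colHeight T s (suc r) λ i i≤r →
        <-≤-trans (≰⇒> L≰s) (rowLen′-antitone (≤-pred i≤r))
    from : rowLen′ T r ≤ s → rowLen′ T r + (n ∸ suc r) ≤ s + (n ∸ colHeight T s)
    from L≤s = +-mono-≤ L≤s (<⇒≤ (∸-monoʳ-< (s≤s (colHeight≤ T s r L≤s)) r<n))

  edgePos-horiz≤horiz⇔ : ∀ c s → edgePos T (horiz c) ≤ edgePos T (horiz s) ⇔ c ≤ s
  edgePos-horiz≤horiz⇔ c s = mk⇔ to from
    where
    to : c + (n ∸ colHeight T c) ≤ s + (n ∸ colHeight T s) → c ≤ s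
    to le with c ≤? s
    ... | yes c≤s = c≤s
    ... | no  c≰s =
      ⊥-elim (<⇒≱ (+-mono-<-≤ s<c (∸-monoʳ-≤ n (colHeight-antitone (<⇒≤ s<c)))) le)
      where
      s<c = ≰⇒> c≰s
    from : c ≤ s → c + (n ∸ colHeight T c) ≤ s + (n ∸ colHeight T s)
    from c≤s = +-mono-≤ c≤s (∸-monoʳ-≤ n (colHeight-antitone c≤s))

  edgePos≤horiz⇔ : ∀ {e} → IsBoundaryEdge T e → ∀ s →
    edgePos T e ≤ edgePos T (horiz s) ⇔ newColumn T e ≤ s
  edgePos≤horiz⇔ {vert r}  r<n = edgePos-vert≤horiz⇔ r<n
  edgePos≤horiz⇔ {horiz c} _   = edgePos-horiz≤horiz⇔ c

-- Ribbons

module Ribbon (bi bj ai : ℕ) where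

  extendRow : ℕ → ℕ → List Bool → List Bool
  extendRow i prev x = if i ≡ᵇ bi then pad (suc bj) x
                       else (if (bi <ᵇ i) ∧ (i ≤ᵇ ai) then pad (suc prev) x else x)

  RowExtension-extendRow : ∀ i prev x → RowExtension x (extendRow i prev x)
  RowExtension-extendRow i prev x with i ≡ᵇ bi
  ... | true = RowExtension-pad (suc bj) x
  ... | false with (bi <ᵇ i) ∧ (i ≤ᵇ ai)
  ...   | true  = RowExtension-pad (suc prev) x
  ...   | false = RowExtension-refl x

  length-extendRow-top : ∀ prev x → suc bj ≤ length (extendRow bi prev x)
  length-extendRow-top prev x rewrite ≡ᵇ-refl bi = ≤-length-pad (suc bj) x

  length-extendRow-middle : ∀ {i} prev x → bi < i → i ≤ ai →
                            suc prev ≤ length (extendRow i prev x)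
  length-extendRow-middle prev x bi<i i≤ai
    rewrite ≡ᵇ-false (>⇒≢ bi<i) | <ᵇ-true bi<i | ≤ᵇ-true i≤ai = ≤-length-pad (suc prev) x

  extendRow-below : ∀ {i} prev x → bi ≤ ai → ai < i → extendRow i prev x ≡ x
  extendRow-below prev x bi≤ai ai<i
    rewrite ≡ᵇ-false (>⇒≢ (≤-<-trans bi≤ai ai<i)) | <ᵇ-true (≤-<-trans bi≤ai ai<i)
          | ≤ᵇ-false (<⇒≱ ai<i) = refl

  previousWidth : ℕ → Filling → ℕ → ℕ
  previousWidth prev T zero    = prev
  previousWidth prev T (suc k) = rowLen′ T k

  nth-addRibbonGo : ∀ i prev T k {x} → nth T k ≡ just x →
    nth (addRibbonGo bi bj ai i prev T) k ≡ just (extendRow (i + k) (previousWidth prev T k) x)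
  nth-addRibbonGo i prev (y ∷ ys) zero refl rewrite +-identityʳ i = refl
  nth-addRibbonGo i prev (y ∷ ys) (suc zero) eq rewrite +-suc i 0 =
    nth-addRibbonGo (suc i) (length y) ys zero eq
  nth-addRibbonGo i prev (y ∷ ys) (suc (suc k)) eq rewrite +-suc i (suc k) =
    nth-addRibbonGo (suc i) (length y) ys (suc k) eq

  nth-addRibbonGo-nothing : ∀ i prev T k → nth T k ≡ nothing →
                            nth (addRibbonGo bi bj ai i prev T) k ≡ nothing
  nth-addRibbonGo-nothing i prev []       k       _  = refl
  nth-addRibbonGo-nothing i prev (y ∷ ys) (suc k) eq = nth-addRibbonGo-nothing (suc i) (length y) ys k eq

  pointed-addRibbon⇒ : ∀ T i j → at′ (addRibbon bi bj ai T) i j ≡ just true →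
                       at′ T i j ≡ just true
  pointed-addRibbon⇒ T i j pt with nth T i in eq
  ... | nothing rewrite nth-addRibbonGo-nothing 0 0 T i eq = pt
  ... | just x  rewrite nth-addRibbonGo 0 0 T i eq =
    RowExtension.no-new-points (RowExtension-extendRow i (previousWidth 0 T i) x) j pt

  at′-addRibbon : ∀ T i j {c} → at′ T i j ≡ just c → at′ (addRibbon bi bj ai T) i j ≡ just c
  at′-addRibbon T i j cell with nth T i in eq
  ... | just x rewrite nth-addRibbonGo 0 0 T i eq =
    RowExtension.keeps-cells (RowExtension-extendRow i (previousWidth 0 T i) x) j cell

  rowLen′-addRibbon-≥ : ∀ T k → rowLen′ T k ≤ rowLen′ (addRibbon bi bj ai T) k
  rowLen′-addRibbon-≥ T k with nth T k in eq
  ... | nothing = z≤n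
  ... | just x rewrite nth-addRibbonGo 0 0 T k eq =
    RowExtension.length-≤ (RowExtension-extendRow k (previousWidth 0 T k) x)

  nth-addRibbon-below : ∀ T k → bi ≤ ai → ai < k → nth (addRibbon bi bj ai T) k ≡ nth T k
  nth-addRibbon-below T k bi≤ai ai<k with nth T k in eq
  ... | nothing = nth-addRibbonGo-nothing 0 0 T k eq
  ... | just x rewrite nth-addRibbonGo 0 0 T k eq | extendRow-below (previousWidth 0 T k) x bi≤ai ai<k =
    refl

  addRibbon-cellBelow : ∀ T i j {c} → at′ T i j ≡ just c →
    bi ≤ suc i → suc i ≤ ai → suc i < length T → (suc i ≡ bi → j ≤ bj) →
    j < rowLen′ (addRibbon bi bj ai T) (suc i)
  addRibbon-cellBelow T i j cell bi≤i i≤ai i<n inTopRow with <⇒nth-just T (suc i) i<n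
  ... | x , eq rewrite nth-addRibbonGo 0 0 T (suc i) eq with m≤n⇒m<n∨m≡n bi≤i
  ...   | inj₁ bi<i = <-≤-trans (m<n⇒m<1+n (at′-just⇒< T i j cell))
                                (length-extendRow-middle (rowLen′ T i) x bi<i i≤ai)
  ...   | inj₂ refl = ≤-trans (s≤s (inTopRow refl)) (length-extendRow-top (rowLen′ T i) x)

-- Inserting a row or a column

-- What the proof needs to know about T′ = insertLine T e: `shift` renumbers the columns of T
-- (the rows above the new point keep their index), and every point of T′ strictly right of
-- the new point comes from a point of T above it whose cell below, if any, survives.
record LineInsertion (T : Filling) (e : Edge) : Set where
  field
    shift             : ℕ → ℕ
    shift-mono        : ∀ {j k} → j ≤ k → shift j ≤ shift k
    shift-right       : ∀ {j} → newColumn T e < shift j → newColumn T e ≤ j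
    shiftCell-above   : ∀ i j → i < newRow T e → shiftCell T e (i , j) ≡ (i , shift j)
    newPoint-pointed  : at′ (insertLine T e) (newRow T e) (newColumn T e) ≡ just true
    below-newPoint    : ∀ k → newRow T e < k → rowLen′ (insertLine T e) k ≤ newColumn T e
    newRow<length     : newRow T e < length (insertLine T e)
    right-cells-above : ∀ i j {c} → at′ T i j ≡ just c → newColumn T e ≤ j → i < newRow T e
    point-origin      : ∀ i j′ → at′ (insertLine T e) i j′ ≡ just true →
                        newColumn T e < j′ →
                        ∃[ j ] shift j ≡ j′ × i < newRow T e × at′ T i j ≡ just true
    cellBelow-lift    : ∀ i j → i < newRow T e → newColumn T e < shift j →
                        j < rowLen′ T (suc i) →
                        shift j < rowLen′ (insertLine T e) (suc i)

module _ {T : Filling} {e : Edge} (F : IsFerrers T) (I : LineInsertion T e)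
         {si sj : ℕ} (special : IsSpecialPoint T (si , sj)) where
  open LineInsertion I
  open FerrersShape F

  private
    a b : ℕ
    a = newRow T e
    b = newColumn T e
    T′ : Filling
    T′ = insertLine T e

  newPoint-special-insertLine : sj < b → IsSpecialPoint T′ (a , b)
  newPoint-special-insertLine sj<b =
    isSpecialPoint-intro T′ a b newPoint-pointed below-newPoint covered
    where
    covered : ∀ i j′ → at′ T′ i j′ ≡ just true → b < j′ → j′ < rowLen′ T′ (suc i)
    covered i j′ pt b<j′ with point-origin i j′ pt b<j′
    ... | j , refl , i<a , ptT = cellBelow-lift i j i<a b<j′
      (right-of-special⇒cellBelow special i j ptT (<-≤-trans sj<b (shift-right b<j′)))

  special-above-newRow : b ≤ sj → si < a
  special-above-newRow = right-cells-above si sj (special-pointed T special)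

  newPoint-special-addRibbon : b ≤ sj → IsSpecialPoint (addRibbon (suc si) (shift sj) a T′) (a , b)
  newPoint-special-addRibbon b≤sj =
    isSpecialPoint-intro T″ a b (at′-addRibbon T′ a b newPoint-pointed) below covered
    where
    open Ribbon (suc si) (shift sj) a
    T″ : Filling
    T″ = addRibbon (suc si) (shift sj) a T′
    below : ∀ k → a < k → rowLen′ T″ k ≤ b
    below k a<k rewrite nth-addRibbon-below T′ k (special-above-newRow b≤sj) a<k = below-newPoint k a<k
    covered : ∀ i j′ → at′ T″ i j′ ≡ just true → b < j′ → j′ < rowLen′ T″ (suc i)
    covered i j′ pt b<j′ with point-origin i j′ (pointed-addRibbon⇒ T′ i j′ pt) b<j′
    ... | j , refl , i<a , ptT with cellBelow⊎southwest-of-special special i j ptT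
    ...   | inj₁ below =
      ≤-trans (cellBelow-lift i j i<a b<j′ below) (rowLen′-addRibbon-≥ T′ (suc i))
    ...   | inj₂ (si≤i , j≤sj) =
      addRibbon-cellBelow T′ i (shift j) (pointed-addRibbon⇒ T′ i (shift j) pt) (s≤s si≤i) i<a
        (≤-<-trans i<a newRow<length) (λ { refl → shift-mono j≤sj })

  newPoint-special-insertPoint : (edgePos T e ≤ edgePos T (horiz sj) ⇔ b ≤ sj) →
    IsSpecialPoint (insertPoint T e (si , sj)) (newPoint T e)
  newPoint-special-insertPoint order
    with edgePos T (horiz sj) <ᵇ edgePos T e | <ᵇ-reflects-< (edgePos T (horiz sj)) (edgePos T e)
  ... | true  | ofʸ northeast =
    newPoint-special-insertLine (≰⇒> (λ b≤sj → <⇒≱ northeast (Equivalence.from order b≤sj)))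
  ... | false | ofⁿ ¬northeast =
    subst (λ s → IsSpecialPoint (addRibbon (suc (proj₁ s)) (proj₂ s) a T′) (a , b))
          (sym (shiftCell-above si sj (special-above-newRow b≤sj)))
          (newPoint-special-addRibbon b≤sj)
    where
    b≤sj : b ≤ sj
    b≤sj = Equivalence.to order (≮⇒≥ ¬northeast)

length-insCol : ∀ L r T → length (insCol L r T) ≡ length T
length-insCol L r       []       = refl
length-insCol L zero    (x ∷ xs) = refl
length-insCol L (suc r) (x ∷ xs) = cong suc (length-insCol L r xs)

nth-insCol-≤ : ∀ L r T k {x} → k ≤ r → nth T k ≡ just x →
               nth (insCol L r T) k ≡ just (insertAt L (k ≡ᵇ r) x)
nth-insCol-≤ L zero    (y ∷ ys) zero    _        refl = refl
nth-insCol-≤ L (suc r) (y ∷ ys) zero    _        refl = refl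
nth-insCol-≤ L (suc r) (y ∷ ys) (suc k) (s≤s le) eq   = nth-insCol-≤ L r ys k le eq

nth-insCol-> : ∀ L r T k → r < k → nth (insCol L r T) k ≡ nth T k
nth-insCol-> L r       []       k       _        = refl
nth-insCol-> L zero    (y ∷ ys) (suc k) _        = refl
nth-insCol-> L (suc r) (y ∷ ys) (suc k) (s≤s lt) = nth-insCol-> L r ys k lt

module VerticalInsertion {T : Filling} (F : IsFerrers T) {r : ℕ} (r<n : r < length T) where
  open FerrersShape F

  private
    L : ℕ
    L = rowLen T r
    T′ : Filling
    T′ = insCol L r T

  L≤rowLen′ : ∀ {k} → k ≤ r → L ≤ rowLen′ T k
  L≤rowLen′ k≤r = subst (_≤ _) (sym (rowLen≡rowLen′ T r)) (rowLen′-antitone k≤r)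

  rowLen′≤L : ∀ {k} → r ≤ k → rowLen′ T k ≤ L
  rowLen′≤L r≤k = subst (_ ≤_) (sym (rowLen≡rowLen′ T r)) (rowLen′-antitone r≤k)

  row-above : ∀ k → k ≤ r → ∃[ x ] nth T k ≡ just x × L ≤ length x
  row-above k k≤r with <⇒nth-just T k (≤-<-trans k≤r r<n)
  ... | x , eq = x , eq , subst (L ≤_) (cong widthOf eq) (L≤rowLen′ k≤r)

  rowLen′-insCol-≤ : ∀ k → k ≤ r → rowLen′ T′ k ≡ suc (rowLen′ T k)
  rowLen′-insCol-≤ k k≤r with row-above k k≤r
  ... | x , eq , L≤x rewrite nth-insCol-≤ L r T k k≤r eq | eq = length-insertAt L (k ≡ᵇ r) x L≤x

  at′-insCol-right : ∀ k j → k ≤ r → L ≤ j → at′ T′ k (suc j) ≡ at′ T k j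
  at′-insCol-right k j k≤r L≤j with row-above k k≤r
  ... | x , eq , _ rewrite nth-insCol-≤ L r T k k≤r eq | eq = nth-insertAt-> L (k ≡ᵇ r) x j L≤j

  at′-insCol-> : ∀ k j → r < k → at′ T′ k j ≡ at′ T k j
  at′-insCol-> k j r<k = cong (λ row → cellOf row j) (nth-insCol-> L r T k r<k)

  shift : ℕ → ℕ
  shift j = if L ≤ᵇ j then suc j else j

  shift-≥ : ∀ {j} → L ≤ j → shift j ≡ suc j
  shift-≥ L≤j rewrite ≤ᵇ-true L≤j = refl

  shift-< : ∀ {j} → j < L → shift j ≡ j
  shift-< j<L rewrite ≤ᵇ-false (<⇒≱ j<L) = refl

  insertion : LineInsertion T (vert r)
  insertion = record
    { shift             = shift
    ; shift-mono        = shift-mono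
    ; shift-right       = shift-right
    ; shiftCell-above   = λ _ _ _ → refl
    ; newPoint-pointed  = newPoint-pointed
    ; below-newPoint    = λ k r<k → subst (_≤ L) (sym (cong widthOf (nth-insCol-> L r T k r<k)))
                                          (rowLen′≤L (<⇒≤ r<k))
    ; newRow<length     = subst (r <_) (sym (length-insCol L r T)) r<n
    ; right-cells-above = right-cells-above
    ; point-origin      = point-origin
    ; cellBelow-lift    = cellBelow-lift
    }
    where
    shift-mono : ∀ {j k} → j ≤ k → shift j ≤ shift k
    shift-mono {j} {k} j≤k with L ≤? j | L ≤? k
    ... | yes L≤j | yes L≤k rewrite shift-≥ L≤j | shift-≥ L≤k = s≤s j≤k
    ... | yes L≤j | no  L≰k = ⊥-elim (L≰k (≤-trans L≤j j≤k))
    ... | no  L≰j | yes L≤k rewrite shift-< (≰⇒> L≰j) | shift-≥ L≤k = m≤n⇒m≤1+n j≤k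
    ... | no  L≰j | no  L≰k rewrite shift-< (≰⇒> L≰j) | shift-< (≰⇒> L≰k) = j≤k

    shift-right : ∀ {j} → L < shift j → L ≤ j
    shift-right {j} L<shift with L ≤? j
    ... | yes L≤j = L≤j
    ... | no  L≰j = ⊥-elim (<-asym (subst (L <_) (shift-< (≰⇒> L≰j)) L<shift) (≰⇒> L≰j))

    newPoint-pointed : at′ T′ r L ≡ just true
    newPoint-pointed with row-above r ≤-refl
    ... | x , eq , L≤x rewrite nth-insCol-≤ L r T r ≤-refl eq | ≡ᵇ-refl r =
      nth-insertAt-≡ L true x L≤x

    right-cells-above : ∀ i j {c} → at′ T i j ≡ just c → L ≤ j → i < r
    right-cells-above i j cell L≤j with i <? r
    ... | yes i<r = i<r
    ... | no  i≮r =
      ⊥-elim (<⇒≱ (at′-just⇒< T i j cell) (≤-trans (rowLen′≤L (≮⇒≥ i≮r)) L≤j))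

    point-origin : ∀ i j′ → at′ T′ i j′ ≡ just true → L < j′ →
                   ∃[ j ] shift j ≡ j′ × i < r × at′ T i j ≡ just true
    point-origin i (suc j) pt (s≤s L≤j) with <-cmp i r
    ... | tri< i<r _ _ =
      j , shift-≥ L≤j , i<r , trans (sym (at′-insCol-right i j (<⇒≤ i<r) L≤j)) pt
    ... | tri≈ _ refl _ =
      ⊥-elim (<⇒≱ (at′-just⇒< T r j (trans (sym (at′-insCol-right r j ≤-refl L≤j)) pt))
                  (≤-trans (rowLen′≤L ≤-refl) L≤j))
    ... | tri> _ _ r<i =
      ⊥-elim (<⇒≱ (at′-just⇒< T i (suc j) (trans (sym (at′-insCol-> i (suc j) r<i)) pt))
                  (≤-trans (rowLen′≤L (<⇒≤ r<i)) (m≤n⇒m≤1+n L≤j)))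

    cellBelow-lift : ∀ i j → i < r → L < shift j → j < rowLen′ T (suc i) →
                     shift j < rowLen′ T′ (suc i)
    cellBelow-lift i j i<r L<shift below
      rewrite shift-≥ (shift-right L<shift) | rowLen′-insCol-≤ (suc i) i<r = s≤s below

nth-newRowCells : ∀ c → nth (replicate c false ++ [ true ]) c ≡ just true
nth-newRowCells zero    = refl
nth-newRowCells (suc c) = nth-newRowCells c

length-newRowCells : ∀ c → length (replicate c false ++ [ true ]) ≡ suc c
length-newRowCells zero    = refl
length-newRowCells (suc c) = cong suc (length-newRowCells c)

module HorizontalInsertion {T : Filling} (F : IsFerrers T) (c : ℕ) where
  open FerrersShape F

  private
    h : ℕ
    h = colHeight T c
    newRowCells : List Bool
    newRowCells = replicate c false ++ [ true ]
    T′ : Filling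
    T′ = insertAt h newRowCells T
    h≤n : h ≤ length T
    h≤n = colHeight≤length T c

  nth-new : nth T′ h ≡ just newRowCells
  nth-new = nth-insertAt-≡ h newRowCells T h≤n

  nth-above : ∀ k → k < h → nth T′ k ≡ nth T k
  nth-above k k<h = nth-insertAt-< h newRowCells T k h≤n k<h

  nth-below : ∀ k → h ≤ k → nth T′ (suc k) ≡ nth T k
  nth-below k h≤k = nth-insertAt-> h newRowCells T k h≤k

  rowLen′-below : ∀ {k} → h ≤ k → rowLen′ T k ≤ c
  rowLen′-below h≤k = ≤-trans (rowLen′-antitone h≤k) (rowLen′-colHeight T c)

  insertion : LineInsertion T (horiz c)
  insertion = record
    { shift             = λ j → j
    ; shift-mono        = λ j≤k → j≤k
    ; shift-right       = <⇒≤
    ; shiftCell-above   = shiftCell-above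
    ; newPoint-pointed  = subst (λ row → cellOf row c ≡ just true) (sym nth-new) (nth-newRowCells c)
    ; below-newPoint    = below-newPoint
    ; newRow<length     = subst (h <_) (sym (length-insertAt h newRowCells T h≤n)) (s≤s h≤n)
    ; right-cells-above = λ i j cell c≤j →
                            <-≤-trans (at′-just⇒<colHeight i j cell) (colHeight-antitone c≤j)
    ; point-origin      = point-origin
    ; cellBelow-lift    = cellBelow-lift
    }
    where
    shiftCell-above : ∀ i j → i < h → shiftCell T (horiz c) (i , j) ≡ (i , j)
    shiftCell-above i j i<h rewrite ≤ᵇ-false (<⇒≱ i<h) = refl

    below-newPoint : ∀ k → h < k → rowLen′ T′ k ≤ c
    below-newPoint (suc k) (s≤s h≤k) rewrite nth-below k h≤k = rowLen′-below h≤k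

    point-origin : ∀ i j → at′ T′ i j ≡ just true → c < j →
                   ∃[ j′ ] j′ ≡ j × i < h × at′ T i j′ ≡ just true
    point-origin i j pt c<j with <-cmp i h
    ... | tri< i<h _ _ = j , refl , i<h , subst (λ row → cellOf row j ≡ just true) (nth-above i i<h) pt
    ... | tri≈ _ refl _ =
      ⊥-elim (<⇒≱ (at′-just⇒< T′ h j pt)
                  (subst (_≤ j) (sym (trans (cong widthOf nth-new) (length-newRowCells c))) c<j))
    point-origin (suc k) j pt c<j | tri> _ _ (s≤s h≤k) =
      ⊥-elim (<⇒≱ (at′-just⇒< T k j
                     (subst (λ row → cellOf row j ≡ just true) (nth-below k h≤k) pt))
                  (≤-trans (rowLen′-below h≤k) (<⇒≤ c<j)))

    cellBelow-lift : ∀ i j → i < h → c < j → j < rowLen′ T (suc i) → j < rowLen′ T′ (suc i)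
    cellBelow-lift i j i<h c<j below with m≤n⇒m<n∨m≡n i<h
    ... | inj₁ i+1<h = subst (j <_) (sym (cong widthOf (nth-above (suc i) i+1<h))) below
    ... | inj₂ i+1≡h =
      ⊥-elim (<⇒≱ below (≤-trans (rowLen′-below (≤-reflexive (sym i+1≡h))) (<⇒≤ c<j)))

lineInsertion : ∀ {T e} → IsFerrers T → IsBoundaryEdge T e → LineInsertion T e
lineInsertion {e = vert r}  F r<n = VerticalInsertion.insertion F r<n
lineInsertion {e = horiz c} F _   = HorizontalInsertion.insertion F c

lemma2p4 : (T : Filling) → IsTreeLike T →
    (e : Edge) → IsBoundaryEdge T e →
    (si sj : ℕ) → IsSpecialPoint T (si , sj) →
    IsSpecialPoint (insertPoint T e (si , sj)) (newPoint T e)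
lemma2p4 T treeLike e e∈∂T si sj special =
  newPoint-special-insertPoint F (lineInsertion F e∈∂T) special (edgePos≤horiz⇔ F e∈∂T sj)
  where
  F : IsFerrers T
  F = IsTreeLike.ferrers treeLike
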